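{- Let $k \geq 2$ and let $G$ be a graph on $n \geq 4k$ vertices with $\sigma_2(G) \geq 6k-2$ such that $G$ does not contain $k$ vertex-disjoint chorded cycles, but $G + e$ does for every $e \in E(\overline{G})$. Let $\mathcal C$ be a collection of $k-1$ vertex-disjoint chorded cycles of $G$ chosen so that (O1) the total number of vertices in the cycles of $\mathcal C$ is minimum; (O2) subject to (O1), the total number of chords is maximum; (O3) subject to (O1) and (O2), the number of vertices of a longest path in $R := G - \bigcup_{C \in \mathcal C} V(C)$ is maximum. Let $C \in \mathcal C$ with $|C| = 6$, and let $u, v \in V(R)$ with $uv \in E(G)$. If $\|u,C\| = 3$ and $\|v,C\| \geq 1$, then $N_C(u) \cap N_C(v) = \emptyset$.
   Context: All graphs are finite and simple. $\sigma_2(G) := \min\{d_G(x)+d_G(y) : x \neq y,\ xy \notin E(G)\}$. A chorded cycle is a cycle together with at least one chord (an edge of $G$ joining two non-consecutive vertices of the cycle). $|C|$ is the number of vertices of $C$; $N_C(u) := N_G(u) \cap V(C)$ and $\|u,C\| := |N_C(u)|$. -}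

module Defs where

open import Data.Nat using (ℕ; zero; suc; _+_; _∸_; _*_; _≤_; _≥_; _≡ᵇ_; _<ᵇ_)
open import Data.Fin using (Fin; toℕ)
open import Data.Bool using (Bool; true; false; if_then_else_; _∧_; _∨_; not)
open import Data.Product using (Σ; _×_; ∃; ∃-syntax)
open import Relation.Binary.PropositionalEquality using (_≡_; _≢_)
open import Relation.Nullary using (¬_)
open import Relation.Nullary.Decidable using (⌊_⌋)
open import Data.Fin using (_≟_)

AdjRel : ℕ → Set
AdjRel n = Fin n → Fin n → Bool

IsSimple : ∀ {n} → AdjRel n → Set
IsSimple {n} G = (∀ x y → G x y ≡ G y x) × (∀ x → G x x ≡ false)

count : (m : ℕ) → (Fin m → Bool) → ℕ
count zero    p = 0
count (suc m) p = (if p Data.Fin.zero then 1 else 0) + count m (λ i → p (Data.Fin.suc i))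

sumFin : (m : ℕ) → (Fin m → ℕ) → ℕ
sumFin zero    f = 0
sumFin (suc m) f = f Data.Fin.zero + sumFin m (λ i → f (Data.Fin.suc i))

deg : ∀ {n} → AdjRel n → Fin n → ℕ
deg {n} G x = count n (G x)

σ₂≥ : ∀ {n} → AdjRel n → ℕ → Set
σ₂≥ G s = ∀ x y → x ≢ y → G x y ≡ false → s ≤ deg G x + deg G y

addEdge : ∀ {n} → AdjRel n → Fin n → Fin n → AdjRel n
addEdge G x y a b =
  G a b ∨ ((⌊ a ≟ x ⌋ ∧ ⌊ b ≟ y ⌋) ∨ (⌊ a ≟ y ⌋ ∧ ⌊ b ≟ x ⌋))

-- Cycles: positions Fin m (m ≥ 3), injective vertex map; position j
-- follows position i cyclically.

next? : (m : ℕ) → Fin m → Fin m → Bool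
next? m i j = (suc (toℕ i) ≡ᵇ toℕ j) ∨ ((suc (toℕ i) ≡ᵇ m) ∧ (toℕ j ≡ᵇ 0))

consec? : (m : ℕ) → Fin m → Fin m → Bool
consec? m i j = next? m i j ∨ next? m j i

record Cycle {n : ℕ} (G : AdjRel n) : Set where
  field
    len   : ℕ
    len≥3 : 3 ≤ len
    vert  : Fin len → Fin n
    inj   : ∀ i j → vert i ≡ vert j → i ≡ j
    edges : ∀ i j → next? len i j ≡ true → G (vert i) (vert j) ≡ true
open Cycle public

HasChord : ∀ {n} {G : AdjRel n} → Cycle G → Set
HasChord {G = G} C =
  ∃[ i ] ∃[ j ] (i ≢ j × consec? (len C) i j ≡ false
               × G (vert C i) (vert C j) ≡ true)

record ChordedCycle {n : ℕ} (G : AdjRel n) : Set where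
  field
    cyc   : Cycle G
    chord : HasChord cyc
open ChordedCycle public

numChords : ∀ {n} {G : AdjRel n} → Cycle G → ℕ
numChords {G = G} C =
  sumFin (len C) (λ i → count (len C) (λ j →
    (toℕ i <ᵇ toℕ j) ∧ not (consec? (len C) i j) ∧ G (vert C i) (vert C j)))

OnCycle : ∀ {n} {G : AdjRel n} → Fin n → Cycle G → Set
OnCycle x C = ∃[ i ] vert C i ≡ x

nbrsOn : ∀ {n} {G : AdjRel n} → Fin n → Cycle G → ℕ
nbrsOn {G = G} u C = count (len C) (λ i → G u (vert C i))

Collection : ∀ {n} → AdjRel n → ℕ → Set
Collection G t = Fin t → ChordedCycle G

Disjoint : ∀ {n} {G : AdjRel n} {t} → Collection G t → Set
Disjoint {t = t} 𝒞 = ∀ (a b : Fin t) (x : _) → a ≢ b →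
  OnCycle x (cyc (𝒞 a)) → ¬ OnCycle x (cyc (𝒞 b))

HasDisjointChorded : ∀ {n} → AdjRel n → ℕ → Set
HasDisjointChorded G t = Σ (Collection G t) Disjoint

Covered : ∀ {n} {G : AdjRel n} {t} → Collection G t → Fin n → Set
Covered 𝒞 x = ∃[ a ] OnCycle x (cyc (𝒞 a))

totalVerts : ∀ {n} {G : AdjRel n} {t} → Collection G t → ℕ
totalVerts {t = t} 𝒞 = sumFin t (λ a → len (cyc (𝒞 a)))

totalChords : ∀ {n} {G : AdjRel n} {t} → Collection G t → ℕ
totalChords {t = t} 𝒞 = sumFin t (λ a → numChords (cyc (𝒞 a)))

-- Paths in R = G - ⋃ V(C) : injective sequence of uncovered vertices
-- with consecutive ones adjacent; pathLen = number of vertices.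

record PathOutside {n : ℕ} {G : AdjRel n} {t : ℕ} (𝒞 : Collection G t) : Set where
  field
    pathLen : ℕ
    pv      : Fin pathLen → Fin n
    pinj    : ∀ i j → pv i ≡ pv j → i ≡ j
    pedge   : ∀ i j → suc (toℕ i) ≡ toℕ j → G (pv i) (pv j) ≡ true
    poutside : ∀ i → ¬ Covered 𝒞 (pv i)
open PathOutside public

Optimal : ∀ {n} (G : AdjRel n) (t : ℕ) → Collection G t → Set
Optimal G t 𝒞 =
  Disjoint 𝒞 ×
  (∀ (𝒟 : Collection G t) → Disjoint 𝒟 → totalVerts 𝒞 ≤ totalVerts 𝒟) ×
  (∀ (𝒟 : Collection G t) → Disjoint 𝒟 → totalVerts 𝒟 ≡ totalVerts 𝒞 →
     totalChords 𝒟 ≤ totalChords 𝒞) ×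
  (∀ (𝒟 : Collection G t) → Disjoint 𝒟 → totalVerts 𝒟 ≡ totalVerts 𝒞 →
     totalChords 𝒟 ≡ totalChords 𝒞 →
     ∀ (P : PathOutside 𝒟) → ∃[ Q ] (pathLen {𝒞 = 𝒟} P ≤ pathLen {𝒞 = 𝒞} Q))

module Submission where

-- Write C = x₀ … x₅ for the 6-cycle of 𝒞 and let xᵢ be a common
-- neighbour of u and v.  Only one position of a 6-cycle (the antipode of i)
-- is at distance 3 from i, so among the three neighbours of u on C there is
-- some x_j at distance 1 or 2 from xᵢ.  Then u v xᵢ … x_j u is a cycle on 4 or
-- 5 vertices with chord u xᵢ; it avoids the other cycles of 𝒞 because u and v
-- lie in R.  Replacing C by it lowers the total number of vertices of 𝒞,
-- contradicting (O1).

open import Defs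
open import Data.Nat using (ℕ; zero; suc; _+_; _∸_; _*_; _≤_; _<_; z≤n; s≤s)
open import Data.Nat.DivMod using (_mod_)
import Data.Nat.Properties as ℕ
open import Data.Nat.Properties using (suc-injective)
open import Data.Fin using (Fin; zero; suc; toℕ; fromℕ; inject≤; _≟_)
open import Data.Fin.Properties using (all?; toℕ-injective; toℕ-fromℕ; toℕ-inject≤)
open import Data.Bool using (Bool; true; false; _∨_)
import Data.Bool.Properties as Bool
open import Data.Vec.Functional using (_∷_; updateAt)
open import Data.Vec.Functional.Properties using (updateAt-updates; updateAt-minimal)
open import Data.Product using (Σ; _×_; _,_; ∃-syntax; proj₁; proj₂)
import Data.Product as Product
open import Data.Empty using (⊥; ⊥-elim)
open import Data.Sum using (_⊎_; inj₁; inj₂)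
import Data.Sum as Sum
open import Function using (_∘_; const)
open import Function.Bundles using (Equivalence)
open import Relation.Binary.PropositionalEquality using (_≡_; _≢_; refl; sym; trans; subst; cong)
open import Relation.Nullary using (¬_; yes; no; does)
open import Relation.Nullary.Decidable using (from-yes; dec-true; _→-dec_; _⊎-dec_)

open Equivalence using (to; from)

clash : ∀ {A : Set} {b : Bool} → b ≡ true → b ≡ false → A
clash refl ()

next?-sound : ∀ m (i j : Fin m) → next? m i j ≡ true →
  suc (toℕ i) ≡ toℕ j ⊎ (suc (toℕ i) ≡ m × toℕ j ≡ 0)
next?-sound m i j e =
  Sum.map (ℕ.≡ᵇ⇒≡ _ _) (Product.map (ℕ.≡ᵇ⇒≡ _ _) (ℕ.≡ᵇ⇒≡ _ _) ∘ to Bool.T-∧)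
    (to Bool.T-∨ (from Bool.T-≡ e))

next?-complete : ∀ m (i j : Fin m) → suc (toℕ i) ≡ toℕ j → next? m i j ≡ true
next?-complete m i j e = to Bool.T-≡ (from Bool.T-∨ (inj₁ (ℕ.≡⇒≡ᵇ _ _ e)))

consec?-sound : ∀ m (i j : Fin m) → consec? m i j ≡ true →
  next? m i j ≡ true ⊎ next? m j i ≡ true
consec?-sound m i j e = Sum.map (to Bool.T-≡) (to Bool.T-≡) (to Bool.T-∨ (from Bool.T-≡ e))

count-mono : ∀ m (f g : Fin m → Bool) → (∀ k → f k ≡ true → g k ≡ true) →
  count m f ≤ count m g
count-mono zero    f g f⇒g = z≤n
count-mono (suc m) f g f⇒g
  with f zero in f₀ | g zero in g₀ | count-mono m (f ∘ suc) (g ∘ suc) (f⇒g ∘ suc)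
... | true  | true  | rest = s≤s rest
... | true  | false | _    = clash (f⇒g zero f₀) g₀
... | false | true  | rest = ℕ.m≤n⇒m≤1+n rest
... | false | false | rest = rest

sumFin-mono : ∀ t (f g : Fin t → ℕ) → (∀ a → f a ≤ g a) → sumFin t f ≤ sumFin t g
sumFin-mono zero    f g f≤g = z≤n
sumFin-mono (suc t) f g f≤g =
  ℕ.+-mono-≤ (f≤g zero) (sumFin-mono t (f ∘ suc) (g ∘ suc) (f≤g ∘ suc))

sumFin-< : ∀ t (f g : Fin t → ℕ) (c : Fin t) → (∀ a → f a ≤ g a) → f c < g c →
  sumFin t f < sumFin t g
sumFin-< (suc t) f g zero    f≤g fc<gc =
  ℕ.+-mono-<-≤ fc<gc (sumFin-mono t (f ∘ suc) (g ∘ suc) (f≤g ∘ suc))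
sumFin-< (suc t) f g (suc c) f≤g fc<gc =
  ℕ.+-mono-≤-< (f≤g zero) (sumFin-< t (f ∘ suc) (g ∘ suc) c (f≤g ∘ suc) fc<gc)

IsPath : ∀ {n} (G : AdjRel n) {ℓ} → (Fin ℓ → Fin n) → Set
IsPath G p = (∀ a b → p a ≡ p b → a ≡ b) × (∀ a b → suc (toℕ a) ≡ toℕ b → G (p a) (p b) ≡ true)

cycle-segment : ∀ {n} {G : AdjRel n} (C : Cycle G) {ℓ} (le : ℓ ≤ len C) →
  IsPath G (λ k → vert C (inject≤ k le))
cycle-segment {G = G} C le = injective , edge
  where
  injective : ∀ a b → vert C (inject≤ a le) ≡ vert C (inject≤ b le) → a ≡ b
  injective a b e = toℕ-injective
    (trans (sym (toℕ-inject≤ a le)) (trans (cong toℕ (inj C _ _ e)) (toℕ-inject≤ b le)))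
  edge : ∀ a b → suc (toℕ a) ≡ toℕ b → G (vert C (inject≤ a le)) (vert C (inject≤ b le)) ≡ true
  edge a b e = edges C _ _ (next?-complete _ _ _
    (trans (cong suc (toℕ-inject≤ a le)) (trans e (sym (toℕ-inject≤ b le)))))

closePath : ∀ {n} {G : AdjRel n} (m : ℕ) (p : Fin (2 + m) → Fin n) → IsPath G p →
  (u v : Fin n) → u ≢ v → (∀ k → p k ≢ u) → (∀ k → p k ≢ v) →
  G u v ≡ true → G v (p zero) ≡ true → G (p (fromℕ (suc m))) u ≡ true →
  G u (p zero) ≡ true →
  Σ (ChordedCycle G) λ D → len (cyc D) ≡ 4 + m ×
    (∀ x → OnCycle x (cyc D) → x ≡ u ⊎ x ≡ v ⊎ ∃[ k ] p k ≡ x)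
closePath {n} {G} m p (p-injective , p-edge) u v u≢v p≢u p≢v uv vp₀ pₗu up₀ =
  D , refl , onD
  where
  w : Fin (4 + m) → Fin n
  w = u ∷ v ∷ p

  w-injective : ∀ a b → w a ≡ w b → a ≡ b
  w-injective zero          zero          _ = refl
  w-injective zero          (suc zero)    e = ⊥-elim (u≢v e)
  w-injective zero          (suc (suc b)) e = ⊥-elim (p≢u b (sym e))
  w-injective (suc zero)    zero          e = ⊥-elim (u≢v (sym e))
  w-injective (suc zero)    (suc zero)    _ = refl
  w-injective (suc zero)    (suc (suc b)) e = ⊥-elim (p≢v b (sym e))
  w-injective (suc (suc a)) zero          e = ⊥-elim (p≢u a e)
  w-injective (suc (suc a)) (suc zero)    e = ⊥-elim (p≢v a e)
  w-injective (suc (suc a)) (suc (suc b)) e = cong (λ k → suc (suc k)) (p-injective a b e)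

  w-edge : ∀ a b → suc (toℕ a) ≡ toℕ b ⊎ (suc (toℕ a) ≡ 4 + m × toℕ b ≡ 0) →
    G (w a) (w b) ≡ true
  w-edge zero          (suc zero)          _             = uv
  w-edge (suc zero)    (suc (suc zero))    _             = vp₀
  w-edge (suc (suc a)) (suc (suc b))       (inj₁ e)      = p-edge a b (suc-injective (suc-injective e))
  w-edge (suc (suc a)) zero                (inj₂ (e , _)) =
    subst (λ k → G (p k) u ≡ true) (sym a-is-last) pₗu
    where
    a-is-last : a ≡ fromℕ (suc m)
    a-is-last = toℕ-injective
      (trans (suc-injective (suc-injective (suc-injective e))) (sym (toℕ-fromℕ (suc m))))
  w-edge zero          _                   (inj₂ (() , _))
  w-edge (suc zero)    _                   (inj₂ (() , _))
  w-edge (suc (suc _)) (suc _)             (inj₂ (_ , ()))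
  w-edge zero          zero                (inj₁ ())
  w-edge zero          (suc (suc _))       (inj₁ ())
  w-edge (suc zero)    zero                (inj₁ ())
  w-edge (suc zero)    (suc zero)          (inj₁ ())
  w-edge (suc zero)    (suc (suc (suc _))) (inj₁ ())
  w-edge (suc (suc _)) zero                (inj₁ ())
  w-edge (suc (suc _)) (suc zero)          (inj₁ ())

  -- positions 0 and 2 (u and p₀) are not consecutive, so u p₀ is a chord
  D : ChordedCycle G
  D = record
    { cyc   = record { len = 4 + m ; len≥3 = s≤s (s≤s (s≤s z≤n)) ; vert = w
                     ; inj = w-injective
                     ; edges = λ a b e → w-edge a b (next?-sound (4 + m) a b e) }
    ; chord = zero , suc (suc zero) , (λ ()) , refl , up₀ }

  onD : ∀ x → OnCycle x (cyc D) → x ≡ u ⊎ x ≡ v ⊎ ∃[ k ] p k ≡ x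
  onD x (zero , e)          = inj₁ (sym e)
  onD x (suc zero , e)      = inj₂ (inj₁ (sym e))
  onD x (suc (suc k) , e)   = inj₂ (inj₂ (k , e))

-- Minimality (O1) forbids replacing a cycle 𝒞 c of a disjoint collection by a
-- strictly shorter chorded cycle D whose vertices are uncovered or lie on 𝒞 c:
-- the updated collection is still disjoint and has fewer vertices.
noShorterReplacement : ∀ {n} {G : AdjRel n} {t} (𝒞 : Collection G t) → Disjoint 𝒞 →
  (∀ 𝒟 → Disjoint 𝒟 → totalVerts 𝒞 ≤ totalVerts 𝒟) →
  (c : Fin t) (D : ChordedCycle G) → len (cyc D) < len (cyc (𝒞 c)) →
  (∀ x → OnCycle x (cyc D) → ¬ Covered 𝒞 x ⊎ OnCycle x (cyc (𝒞 c))) → ⊥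
noShorterReplacement {G = G} {t} 𝒞 disjoint minimal c D shorter D⊆ =
  ℕ.<⇒≱ fewer (minimal 𝒟 𝒟-disjoint)
  where
  𝒟 : Collection G t
  𝒟 = updateAt 𝒞 c (const D)

  replaced : ∀ a → (a ≡ c × 𝒟 a ≡ D) ⊎ (a ≢ c × 𝒟 a ≡ 𝒞 a)
  replaced a with a ≟ c
  ... | yes refl = inj₁ (refl , updateAt-updates a 𝒞)
  ... | no a≢c   = inj₂ (a≢c , updateAt-minimal a c 𝒞 a≢c)

  on : ∀ {x E F} → E ≡ F → OnCycle x (cyc E) → OnCycle x (cyc F)
  on {x} = subst (λ E → OnCycle x (cyc E))

  D-avoids : ∀ b x → b ≢ c → OnCycle x (cyc D) → ¬ OnCycle x (cyc (𝒞 b))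
  D-avoids b x b≢c onD onB with D⊆ x onD
  ... | inj₁ uncovered = uncovered (b , onB)
  ... | inj₂ onC       = disjoint c b x (b≢c ∘ sym) onC onB

  𝒟-disjoint : Disjoint 𝒟
  𝒟-disjoint a b x a≢b onA onB with replaced a | replaced b
  ... | inj₁ (refl , _)   | inj₁ (refl , _)   = a≢b refl
  ... | inj₁ (refl , 𝒟a) | inj₂ (b≢c , 𝒟b) = D-avoids b x b≢c (on 𝒟a onA) (on 𝒟b onB)
  ... | inj₂ (a≢c , 𝒟a) | inj₁ (refl , 𝒟b) = D-avoids a x a≢c (on 𝒟b onB) (on 𝒟a onA)
  ... | inj₂ (_ , 𝒟a)   | inj₂ (_ , 𝒟b)   = disjoint a b x a≢b (on 𝒟a onA) (on 𝒟b onB)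

  length-bound : ∀ a → len (cyc (𝒟 a)) ≤ len (cyc (𝒞 a))
  length-bound a with replaced a
  ... | inj₁ (refl , 𝒟a) = ℕ.<⇒≤ (subst (λ E → len (cyc E) < _) (sym 𝒟a) shorter)
  ... | inj₂ (_ , 𝒟a)    = ℕ.≤-reflexive (cong (len ∘ cyc) 𝒟a)

  fewer : totalVerts 𝒟 < totalVerts 𝒞
  fewer = sumFin-< t _ _ c length-bound
    (subst (λ E → len (cyc E) < _) (sym (updateAt-updates c 𝒞)) shorter)

walk : Bool → Fin 6 → ℕ → Fin 6
walk true  i d = (toℕ i + d) mod 6
walk false i d = (toℕ i + (6 ∸ d)) mod 6

walk-start : ∀ s i → walk s i 0 ≡ i
walk-start true  = from-yes (all? λ i → walk true i 0 ≟ i)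
walk-start false = from-yes (all? λ i → walk false i 0 ≟ i)

walk-injective : ∀ s i (a b : Fin 6) → walk s i (toℕ a) ≡ walk s i (toℕ b) → a ≡ b
walk-injective true  = from-yes (all? λ i → all? λ (a : Fin 6) → all? λ (b : Fin 6) →
  (walk true i (toℕ a) ≟ walk true i (toℕ b)) →-dec (a ≟ b))
walk-injective false = from-yes (all? λ i → all? λ (a : Fin 6) → all? λ (b : Fin 6) →
  (walk false i (toℕ a) ≟ walk false i (toℕ b)) →-dec (a ≟ b))

walk-consec : ∀ s i (a b : Fin 6) → next? 6 a b ≡ true →
  consec? 6 (walk s i (toℕ a)) (walk s i (toℕ b)) ≡ true
walk-consec true  = from-yes (all? λ i → all? λ (a : Fin 6) → all? λ (b : Fin 6) →
  (next? 6 a b Bool.≟ true) →-dec (consec? 6 (walk true i (toℕ a)) (walk true i (toℕ b)) Bool.≟ true))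
walk-consec false = from-yes (all? λ i → all? λ (a : Fin 6) → all? λ (b : Fin 6) →
  (next? 6 a b Bool.≟ true) →-dec (consec? 6 (walk false i (toℕ a)) (walk false i (toℕ b)) Bool.≟ true))

six-positions : ∀ i k → k ≡ i ⊎ k ≡ walk true i 3 ⊎ k ≡ walk true i 1 ⊎ k ≡ walk false i 1
                ⊎ k ≡ walk true i 2 ⊎ k ≡ walk false i 2
six-positions = from-yes (all? λ i → all? λ k → (k ≟ i) ⊎-dec ((k ≟ walk true i 3) ⊎-dec
  ((k ≟ walk true i 1) ⊎-dec ((k ≟ walk false i 1) ⊎-dec
  ((k ≟ walk true i 2) ⊎-dec (k ≟ walk false i 2))))))

antipodalPair : Fin 6 → Fin 6 → Bool
antipodalPair i k = does (k ≟ i) ∨ does (k ≟ walk true i 3)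

antipodalPair-size : ∀ i → count 6 (antipodalPair i) ≡ 2
antipodalPair-size = from-yes (all? λ i → count 6 (antipodalPair i) ℕ.≟ 2)

closeNeighbour : (f : Fin 6 → Bool) → count 6 f ≡ 3 → (i : Fin 6) →
  Σ Bool λ s → f (walk s i 1) ≡ true ⊎ f (walk s i 2) ≡ true
closeNeighbour f three i
  with f (walk true i 1) in e₁ | f (walk false i 1) in e₂
     | f (walk true i 2) in e₃ | f (walk false i 2) in e₄
... | true  | _     | _     | _     = true  , inj₁ e₁
... | false | true  | _     | _     = false , inj₁ e₂
... | false | false | true  | _     = true  , inj₂ e₃
... | false | false | false | true  = false , inj₂ e₄
... | false | false | false | false =
  ⊥-elim (ℕ.<-irrefl refl (subst (_≤ 2) three
    (ℕ.≤-trans (count-mono 6 f (antipodalPair i) antipodal) (ℕ.≤-reflexive (antipodalPair-size i)))))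
  where
  -- otherwise f can only hold at i and its antipode, so count 6 f ≤ 2
  antipodal : ∀ k → f k ≡ true → antipodalPair i k ≡ true
  antipodal k fk with six-positions i k
  ... | inj₁ k≡i = cong (_∨ does (k ≟ walk true i 3)) (dec-true (k ≟ i) k≡i)
  ... | inj₂ (inj₁ k≡i+3) =
    trans (cong (does (k ≟ i) ∨_) (dec-true (k ≟ walk true i 3) k≡i+3)) (Bool.∨-zeroʳ _)
  ... | inj₂ (inj₂ (inj₁ refl)) = clash fk e₁
  ... | inj₂ (inj₂ (inj₂ (inj₁ refl))) = clash fk e₂
  ... | inj₂ (inj₂ (inj₂ (inj₂ (inj₁ refl)))) = clash fk e₃
  ... | inj₂ (inj₂ (inj₂ (inj₂ (inj₂ refl)))) = clash fk e₄

module _ {n : ℕ} {G : AdjRel n} (simple : IsSimple G) where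

  adjacent-sym : ∀ {x y} → G x y ≡ true → G y x ≡ true
  adjacent-sym {x} {y} e = trans (proj₁ simple y x) e

  adjacent-distinct : ∀ {x y} → G x y ≡ true → x ≢ y
  adjacent-distinct {x} e refl = clash e (proj₂ simple x)

  consecutive-edge : (C : Cycle G) (a b : Fin (len C)) → consec? (len C) a b ≡ true →
    G (vert C a) (vert C b) ≡ true
  consecutive-edge C a b e with consec?-sound (len C) a b e
  ... | inj₁ a→b = edges C a b a→b
  ... | inj₂ b→a = adjacent-sym (edges C b a b→a)

  relabel : (C : Cycle G) (σ : Fin (len C) → Fin (len C)) → (∀ a b → σ a ≡ σ b → a ≡ b) →
    (∀ a b → next? (len C) a b ≡ true → consec? (len C) (σ a) (σ b) ≡ true) → Cycle G
  relabel C σ σ-injective σ-consec = record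
    { len = len C ; len≥3 = len≥3 C ; vert = vert C ∘ σ
    ; inj = λ a b e → σ-injective a b (inj C _ _ e)
    ; edges = λ a b e → consecutive-edge C (σ a) (σ b) (σ-consec a b e) }

  shortcutAlong : (C : Cycle G) (m : ℕ) (le : 2 + m ≤ len C) (u v : Fin n) →
    ¬ OnCycle u C → ¬ OnCycle v C → G u v ≡ true →
    G u (vert C (inject≤ zero le)) ≡ true → G v (vert C (inject≤ zero le)) ≡ true →
    G u (vert C (inject≤ (fromℕ (suc m)) le)) ≡ true →
    Σ (ChordedCycle G) λ D → len (cyc D) ≡ 4 + m ×
      (∀ x → OnCycle x (cyc D) → x ≡ u ⊎ x ≡ v ⊎ OnCycle x C)
  shortcutAlong C m le u v u∉C v∉C uv u~C₀ v~C₀ u~Cₘ₊₁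
    with closePath m (λ k → vert C (inject≤ k le)) (cycle-segment C le) u v
           (adjacent-distinct uv) (λ k e → u∉C (inject≤ k le , e)) (λ k e → v∉C (inject≤ k le , e))
           uv v~C₀ (adjacent-sym u~Cₘ₊₁) u~C₀
  ... | D , length , onD = D , length , λ x → Sum.map₂ (Sum.map₂ λ (k , e) → inject≤ k le , e) ∘ onD x

  shortcutSix : (C : Cycle G) → len C ≡ 6 → (u v : Fin n) → ¬ OnCycle u C → ¬ OnCycle v C →
    G u v ≡ true → nbrsOn u C ≡ 3 → (i : Fin (len C)) →
    G u (vert C i) ≡ true → G v (vert C i) ≡ true →
    Σ (ChordedCycle G) λ D → len (cyc D) < len C ×
      (∀ x → OnCycle x (cyc D) → x ≡ u ⊎ x ≡ v ⊎ OnCycle x C)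
  shortcutSix C@record { len = .6 } refl u v u∉C v∉C uv three i u~Cᵢ v~Cᵢ =
    shortcut (closeNeighbour (λ k → G u (vert C k)) three i)
    where
    Cₛ : Bool → Cycle G
    Cₛ s = relabel C (walk s i ∘ toℕ) (walk-injective s i) (walk-consec s i)

    from-Cₛ : ∀ s {x} → OnCycle x (Cₛ s) → OnCycle x C
    from-Cₛ s (k , e) = walk s i (toℕ k) , e

    along : (s : Bool) (m : ℕ) → 4 + m < 6 → G u (vert C (walk s i (suc m))) ≡ true →
      Σ (ChordedCycle G) λ D → len (cyc D) < 6 ×
        (∀ x → OnCycle x (cyc D) → x ≡ u ⊎ x ≡ v ⊎ OnCycle x C)
    along s m short u~far
      with shortcutAlong (Cₛ s) m le u v (u∉C ∘ from-Cₛ s) (v∉C ∘ from-Cₛ s) uv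
             (at-start u~Cᵢ) (at-start v~Cᵢ)
             (subst (λ d → G u (vert C (walk s i d)) ≡ true) (sym end) u~far)
      where
      le : 2 + m ≤ 6
      le = ℕ.≤-trans (ℕ.m≤n+m (2 + m) 2) (ℕ.<⇒≤ short)
      at-start : ∀ {y} → G y (vert C i) ≡ true → G y (vert C (walk s i 0)) ≡ true
      at-start {y} = subst (λ p → G y (vert C p) ≡ true) (sym (walk-start s i))
      end : toℕ (inject≤ (fromℕ (suc m)) le) ≡ suc m
      end = trans (toℕ-inject≤ _ le) (toℕ-fromℕ (suc m))
    ... | D , length , onD =
      D , subst (_< 6) (sym length) short , λ x → Sum.map₂ (Sum.map₂ (from-Cₛ s)) ∘ onD x

    shortcut : (Σ Bool λ s → G u (vert C (walk s i 1)) ≡ true ⊎ G u (vert C (walk s i 2)) ≡ true) →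
      Σ (ChordedCycle G) λ D → len (cyc D) < 6 ×
        (∀ x → OnCycle x (cyc D) → x ≡ u ⊎ x ≡ v ⊎ OnCycle x C)
    shortcut (s , inj₁ u~Cᵢ₊₁) = along s 0 (ℕ.m≤n⇒m≤1+n ℕ.≤-refl) u~Cᵢ₊₁
    shortcut (s , inj₂ u~Cᵢ₊₂) = along s 1 ℕ.≤-refl u~Cᵢ₊₂

lemma16 : (k n : ℕ) → 2 ≤ k → 4 * k ≤ n →
    (G : AdjRel n) → IsSimple G →
    σ₂≥ G (6 * k ∸ 2) →
    ¬ HasDisjointChorded G k →
    (∀ x y → x ≢ y → G x y ≡ false → HasDisjointChorded (addEdge G x y) k) →
    (𝒞 : Collection G (k ∸ 1)) → Optimal G (k ∸ 1) 𝒞 →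
    (c : Fin (k ∸ 1)) → len (cyc (𝒞 c)) ≡ 6 →
    (u v : Fin n) → ¬ Covered 𝒞 u → ¬ Covered 𝒞 v → G u v ≡ true →
    nbrsOn u (cyc (𝒞 c)) ≡ 3 → 1 ≤ nbrsOn v (cyc (𝒞 c)) →
    ∀ (i : Fin (len (cyc (𝒞 c)))) →
      ¬ (G u (vert (cyc (𝒞 c)) i) ≡ true × G v (vert (cyc (𝒞 c)) i) ≡ true)
lemma16 _ _ _ _ G simple _ _ _ 𝒞 (disjoint , minimal , _) c six u v u∉R v∉R uv three _ i (u~Cᵢ , v~Cᵢ)
  with shortcutSix simple (cyc (𝒞 c)) six u v (u∉R ∘ (c ,_)) (v∉R ∘ (c ,_)) uv three i u~Cᵢ v~Cᵢ
... | D , shorter , onD = noShorterReplacement 𝒞 disjoint minimal c D shorter D⊆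
  where
  -- u and v lie in R, so every vertex of D is in R or on the replaced cycle
  D⊆ : ∀ x → OnCycle x (cyc D) → ¬ Covered 𝒞 x ⊎ OnCycle x (cyc (𝒞 c))
  D⊆ x onD′ with onD x onD′
  ... | inj₁ refl        = inj₁ u∉R
  ... | inj₂ (inj₁ refl) = inj₁ v∉R
  ... | inj₂ (inj₂ onC)  = inj₂ onC
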